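{- Let $k>2$ be an integer and $m$ a positive integer. Define $$U_k(m)=(6m+1)(12m+1)\prod_{i=1}^{k-2}(9\cdot 2^i m+1).$$ Suppose that $6m+1$, $12m+1$ and $9\cdot 2^i m+1$ for $i=1,\dots,k-2$ are all prime, that $m\equiv 0\pmod{2^{k-4}}$ (a vacuous condition when $k=3$), and that $m$ is not a power of $2$. Then $U_k(m)\in L_k\setminus L_{k-1}$.
   Context: $\varphi$ is Euler's totient function. For $k\in\mathbb{N}$, $L_k=\{n\in\mathbb{N} : \varphi(n)\mid (n-1)^k\}$. -}

module Defs where

open import Data.Nat using (ℕ; suc; _+_; _*_; _∸_; _^_)
open import Data.Nat.Coprimality using (Coprime; coprime?)
open import Data.Nat.Divisibility using (_∣_)
open import Data.List using (List; length; filter; applyUpTo)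
open import Data.Nat.ListAction using (product)

-- Euler's totient: φ(n) = #{ j ∈ {1,…,n} : gcd(j,n) = 1 }  (so φ 0 = 0, φ 1 = 1)
φ : ℕ → ℕ
φ n = length (filter (λ j → coprime? j n) (applyUpTo suc n))

L : ℕ → ℕ → Set
L k n = φ n ∣ (n ∸ 1) ^ k

U : ℕ → ℕ → ℕ
U k m = (6 * m + 1) * (12 * m + 1)
        * product (applyUpTo (λ j → 9 * 2 ^ suc j * m + 1) (k ∸ 2))

module Submission where

-- Proof.  (1) Counting the j ≤ pN coprime to pN gives φ(pN) = (p-1)·φ(N) for
-- a prime p ∤ N; since all the factors of U are distinct primes,
-- φ(U) = 6m · 12m · P_n with P_n = ∏_{j<n} 9·2^(j+1)·m.
-- (2) Expanding the product, U = 1 + 9m·S with S ≡ 2^(n+1) (mod 4m).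
-- (3) Hence 4 ∣ S and, as 2^(n-2) ∣ m, also 2^n ∣ S; so 6m and 12m divide
-- U-1, each factor of P_n divides 9·2^n·m ∣ U-1, and φ(U) ∣ (U-1)^(n+2).
-- (4) Conversely m·(9m)^(n+1) ∣ φ(U); if φ(U) ∣ (9mS)^(n+1) then m ∣ S^(n+1),
-- so an odd prime ρ ∣ m divides S, hence 2^(n+1), which is absurd.

open import Defs
open import Data.Nat using (ℕ; suc; _+_; _*_; _∸_; _^_; _<_; _≤_)
open import Data.Nat.Divisibility using (_∣_)
open import Data.Nat.Primality using (Prime)
open import Data.Product using (_×_; ∃-syntax)
open import Relation.Nullary using (¬_)
open import Relation.Binary.PropositionalEquality using (_≡_)

open import Data.Nat.Base using (zero; z≤n; s≤s; z<s; s<s; NonZero; >-nonZero)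
open import Data.Nat.Properties
open import Data.Nat.Divisibility
  using (divides; _∣?_; ∣-refl; ∣-trans; 1∣_; ∣⇒≤; ∣1⇒≡1; n∣m*n; m∣m*n; ∣m⇒∣m*n; ∣n⇒∣m*n;
         ∣m∣n⇒∣m+n; ∣m+n∣m⇒∣n; *-pres-∣; *-monoʳ-∣; *-monoˡ-∣; *-cancelˡ-∣)
open import Data.Nat.Coprimality using (Coprime; coprime?; coprime-+; coprime-divisor)
open import Data.Nat.Primality
  using (¬prime[0]; ¬prime[1]; prime[2]; prime⇒irreducible; euclidsLemma)
open import Data.Nat.Primality.Factorisation
  using (factorise; factorisationHasAllPrimeFactors)
open import Data.Nat.ListAction using (product)
open import Data.Nat.ListAction.Properties using (product-++)
open import Data.Nat.Tactic.RingSolver using (solve-∀)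
open import Data.List using ([]; _∷_; _∷ʳ_; length; filter; applyUpTo)
open import Data.List.Properties using (applyUpTo-∷ʳ)
open import Data.List.Membership.Propositional.Properties using (∈-applyUpTo⁻)
open import Data.List.Relation.Unary.All using (All; []; _∷_)
open import Data.List.Relation.Unary.All.Properties using (applyUpTo⁺₁)
open import Data.Product using (_,_; proj₂)
open import Data.Sum using (_⊎_; inj₁; inj₂)
open import Data.Empty using (⊥-elim)
open import Function using (_∘_)
open import Relation.Nullary using (Dec; yes; no)
open import Relation.Unary using (Decidable)
open import Relation.Unary.Properties using (_∩?_; ∁?)
open import Relation.Binary.PropositionalEquality
  using (refl; sym; trans; cong; cong₂; subst; subst₂; module ≡-Reasoning)

open ≡-Reasoning

indicator : {P : Set} → Dec P → ℕ
indicator (yes _) = 1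
indicator (no _)  = 0

indicator-cong : {P Q : Set} (P? : Dec P) (Q? : Dec Q) → (P → Q) → (Q → P) →
                 indicator P? ≡ indicator Q?
indicator-cong (yes _) (yes _) to from = refl
indicator-cong (no _)  (no _)  to from = refl
indicator-cong (yes p) (no ¬q) to from = ⊥-elim (¬q (to p))
indicator-cong (no ¬p) (yes q) to from = ⊥-elim (¬p (from q))

count : {P : ℕ → Set} → Decidable P → (ℕ → ℕ) → ℕ → ℕ
count P? f zero    = 0
count P? f (suc n) = indicator (P? (f 0)) + count P? (f ∘ suc) n

count-filter : {P : ℕ → Set} (P? : Decidable P) (f : ℕ → ℕ) (n : ℕ) →
               length (filter P? (applyUpTo f n)) ≡ count P? f n
count-filter P? f zero = refl
count-filter P? f (suc n) with P? (f 0)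
... | yes _ = cong suc (count-filter P? (f ∘ suc) n)
... | no  _ = count-filter P? (f ∘ suc) n

φ-count : ∀ N → φ N ≡ count (λ j → coprime? j N) suc N
φ-count N = count-filter (λ j → coprime? j N) suc N

count-cong : {P Q : ℕ → Set} (P? : Decidable P) (Q? : Decidable Q) {f g : ℕ → ℕ} (n : ℕ) →
             (∀ i → i < n → P (f i) → Q (g i)) → (∀ i → i < n → Q (g i) → P (f i)) →
             count P? f n ≡ count Q? g n
count-cong P? Q? zero to from = refl
count-cong P? Q? {f} {g} (suc n) to from = cong₂ _+_
  (indicator-cong (P? (f 0)) (Q? (g 0)) (to 0 z<s) (from 0 z<s))
  (count-cong P? Q? n (λ i i<n → to (suc i) (s<s i<n)) (λ i i<n → from (suc i) (s<s i<n)))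

count-≗ : {P : ℕ → Set} (P? : Decidable P) {f g : ℕ → ℕ} (n : ℕ) →
          (∀ i → f i ≡ g i) → count P? f n ≡ count P? g n
count-≗ {P} P? n f≗g =
  count-cong P? P? n (λ i _ → subst P (f≗g i)) (λ i _ → subst P (sym (f≗g i)))

count-+ : {P : ℕ → Set} (P? : Decidable P) (f : ℕ → ℕ) (n l : ℕ) →
          count P? f (n + l) ≡ count P? f n + count P? (λ i → f (n + i)) l
count-+ P? f zero    l = refl
count-+ P? f (suc n) l =
  trans (cong (indicator (P? (f 0)) +_) (count-+ P? (f ∘ suc) n l)) (sym (+-assoc (indicator (P? (f 0))) _ _))

count-split : {P B : ℕ → Set} (P? : Decidable P) (B? : Decidable B) (f : ℕ → ℕ) (n : ℕ) →
              count P? f n ≡ count (P? ∩? B?) f n + count (P? ∩? ∁? B?) f n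
count-split P? B? f zero = refl
count-split P? B? f (suc n) with P? (f 0) | B? (f 0)
... | yes _ | yes _ = cong suc (count-split P? B? (f ∘ suc) n)
... | yes _ | no  _ = trans (cong suc (count-split P? B? (f ∘ suc) n)) (sym (+-suc _ _))
... | no  _ | yes _ = count-split P? B? (f ∘ suc) n
... | no  _ | no  _ = count-split P? B? (f ∘ suc) n

count-none : {P : ℕ → Set} (P? : Decidable P) (f : ℕ → ℕ) (n : ℕ) →
             (∀ i → i < n → ¬ P (f i)) → count P? f n ≡ 0
count-none P? f zero    none = refl
count-none P? f (suc n) none with P? (f 0)
... | yes p = ⊥-elim (none 0 z<s p)
... | no  _ = count-none P? (f ∘ suc) n (λ i i<n → none (suc i) (s<s i<n))

count-periodic : {P : ℕ → Set} (P? : Decidable P) (f : ℕ → ℕ) (N : ℕ) →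
                 (∀ i → P (f (N + i)) → P (f i)) → (∀ i → P (f i) → P (f (N + i))) →
                 ∀ t → count P? f (t * N) ≡ t * count P? f N
count-periodic P? f N back forth zero    = refl
count-periodic P? f N back forth (suc t) = begin
    count P? f (N + t * N)
  ≡⟨ count-+ P? f N (t * N) ⟩
    count P? f N + count P? (λ i → f (N + i)) (t * N)
  ≡⟨ cong (count P? f N +_) (count-cong P? P? (t * N) (λ i _ → back i) (λ i _ → forth i)) ⟩
    count P? f N + count P? f (t * N)
  ≡⟨ cong (count P? f N +_) (count-periodic P? f N back forth t) ⟩
    count P? f N + t * count P? f N
  ∎

module Multiples {P : ℕ → Set} (P? : Decidable P) (p' : ℕ) where

  private
    p : ℕ
    p = suc p'

  P∣? : Decidable (λ j → P j × p ∣ j)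
  P∣? = P? ∩? (p ∣?_)

  -- In the block (a·p, (a+1)·p] only the right end is a multiple of p.
  block : ∀ a → count P∣? (λ i → a * p + suc i) p ≡ indicator (P? ((a + 1) * p))
  block a = begin
      count P∣? f p
    ≡⟨ cong (count P∣? f) (+-comm 1 p') ⟩
      count P∣? f (p' + 1)
    ≡⟨ count-+ P∣? f p' 1 ⟩
      count P∣? f p' + (indicator (P∣? (f (p' + 0))) + 0)
    ≡⟨ cong₂ _+_ (count-none P∣? f p' (λ i i<p' → not-multiple i i<p' ∘ proj₂)) (+-identityʳ _) ⟩
      indicator (P∣? (f (p' + 0)))
    ≡⟨ indicator-cong (P∣? (f (p' + 0))) (P? ((a + 1) * p))
         (λ (x , _) → subst P end x)
         (λ x → subst P (sym end) x , subst (p ∣_) (sym end) (n∣m*n (a + 1))) ⟩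
      indicator (P? ((a + 1) * p))
    ∎
    where
    f : ℕ → ℕ
    f i = a * p + suc i
    not-multiple : ∀ i → i < p' → ¬ p ∣ f i
    not-multiple i i<p' p∣fi = <⇒≱ (s<s i<p') (∣⇒≤ (∣m+n∣m⇒∣n p∣fi (n∣m*n a)))
    end : f (p' + 0) ≡ (a + 1) * p
    end = ring a p'
      where
      ring : ∀ a p' → a * suc p' + suc (p' + 0) ≡ (a + 1) * suc p'
      ring = solve-∀

  count-multiples : ∀ a t → count P∣? (λ i → a * p + suc i) (t * p)
                          ≡ count P? (λ s → (a + suc s) * p) t
  count-multiples a zero    = refl
  count-multiples a (suc t) = begin
      count P∣? (λ i → a * p + suc i) (p + t * p)
    ≡⟨ count-+ P∣? (λ i → a * p + suc i) p (t * p) ⟩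
      count P∣? (λ i → a * p + suc i) p + count P∣? (λ i → a * p + suc (p + i)) (t * p)
    ≡⟨ cong₂ _+_ (block a) (count-≗ P∣? (t * p) (next-block a)) ⟩
      indicator (P? ((a + 1) * p)) + count P∣? (λ i → suc a * p + suc i) (t * p)
    ≡⟨ cong (indicator (P? ((a + 1) * p)) +_) (count-multiples (suc a) t) ⟩
      indicator (P? ((a + 1) * p)) + count P? (λ s → (suc a + suc s) * p) t
    ≡⟨ cong (indicator (P? ((a + 1) * p)) +_)
            (count-≗ P? t (λ s → cong (_* p) (sym (+-suc a (suc s))))) ⟩
      count P? (λ s → (a + suc s) * p) (suc t)
    ∎
    where
    next-block : ∀ a i → a * p + suc (p + i) ≡ suc a * p + suc i
    next-block a i = ring a p' i
      where
      ring : ∀ a p' i → a * suc p' + suc (suc p' + i) ≡ suc a * suc p' + suc i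
      ring = solve-∀

open Multiples using (count-multiples)

coprime-prime : ∀ {p d} → Prime p → ¬ p ∣ d → Coprime d p
coprime-prime pr p∤d (e∣d , e∣p) with prime⇒irreducible pr e∣p
... | inj₁ e≡1 = e≡1
... | inj₂ refl = ⊥-elim (p∤d e∣d)

coprime-*⁻ : ∀ {p N j} → Prime p → Coprime j (p * N) → Coprime j N × ¬ p ∣ j
coprime-*⁻ {p} {N} pr c =
  (λ (d∣j , d∣N) → c (d∣j , ∣-trans d∣N (n∣m*n p))) ,
  (λ p∣j → ¬prime[1] (subst Prime (c (p∣j , m∣m*n N)) pr))

coprime-*⁺ : ∀ {p N j} → Prime p → Coprime j N → ¬ p ∣ j → Coprime j (p * N)
coprime-*⁺ pr c p∤j (d∣j , d∣pN) =
  c (d∣j , coprime-divisor (coprime-prime pr (p∤j ∘ (λ p∣d → ∣-trans p∣d d∣j))) d∣pN)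

coprime-shift : ∀ {N j} → Coprime (N + j) N → Coprime j N
coprime-shift c (d∣j , d∣N) = c (∣m∣n⇒∣m+n d∣N d∣j , d∣N)

coprime-scale⁻ : ∀ {p N x} → Coprime (x * p) N → Coprime x N
coprime-scale⁻ {p} c (d∣x , d∣N) = c (∣m⇒∣m*n p d∣x , d∣N)

coprime-scale⁺ : ∀ {p N x} → Prime p → ¬ p ∣ N → Coprime x N → Coprime (x * p) N
coprime-scale⁺ {p} {N} {x} pr p∤N c {d} (d∣xp , d∣N) =
  c (coprime-divisor (coprime-prime pr (p∤N ∘ (λ p∣d → ∣-trans p∣d d∣N)))
                     (subst (d ∣_) (*-comm x p) d∣xp) , d∣N)

-- φ(pN) = (p - 1)·φ(N): among the j ≤ pN coprime to N, exactly φ(N) are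
-- multiples of p, while p·φ(N) of them lie in [1, pN] in total.
φ-prime-mul : ∀ {p N} → Prime p → ¬ p ∣ N → φ (p * N) + φ N ≡ p * φ N
φ-prime-mul {zero}       pr = ⊥-elim (¬prime[0] pr)
φ-prime-mul {suc p'} {N} pr p∤N = begin
    φ (p * N) + φ N
  ≡⟨ +-comm (φ (p * N)) (φ N) ⟩
    φ N + φ (p * N)
  ≡⟨ cong₂ _+_ (sym coprime-multiples) coprime-nonmultiples ⟩
    count (A? ∩? B?) suc (p * N) + count (A? ∩? ∁? B?) suc (p * N)
  ≡⟨ sym (count-split A? B? suc (p * N)) ⟩
    count A? suc (p * N)
  ≡⟨ count-periodic A? suc N
       (λ i → coprime-shift ∘ subst (λ x → Coprime x N) (sym (+-suc N i)))
       (λ i → subst (λ x → Coprime x N) (+-suc N i) ∘ coprime-+) p ⟩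
    p * count A? suc N
  ≡⟨ cong (p *_) (sym (φ-count N)) ⟩
    p * φ N
  ∎
  where
  p : ℕ
  p = suc p'
  A? : Decidable (λ j → Coprime j N)
  A? j = coprime? j N
  B? : Decidable (p ∣_)
  B? = p ∣?_
  coprime-nonmultiples : φ (p * N) ≡ count (A? ∩? ∁? B?) suc (p * N)
  coprime-nonmultiples = trans (φ-count (p * N))
    (count-cong _ _ (p * N) (λ i _ → coprime-*⁻ pr) (λ i _ (c , p∤j) → coprime-*⁺ pr c p∤j))
  coprime-multiples : count (A? ∩? B?) suc (p * N) ≡ φ N
  coprime-multiples = begin
      count (A? ∩? B?) suc (p * N)
    ≡⟨ cong (count (A? ∩? B?) suc) (*-comm p N) ⟩
      count (A? ∩? B?) suc (N * p)
    ≡⟨ count-multiples A? p' 0 N ⟩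
      count A? (λ s → suc s * p) N
    ≡⟨ count-cong A? A? N (λ i _ → coprime-scale⁻) (λ i _ → coprime-scale⁺ pr p∤N) ⟩
      count A? suc N
    ≡⟨ sym (φ-count N) ⟩
      φ N
    ∎

φ-prime-factor : ∀ a N → Prime (a + 1) → ¬ (a + 1) ∣ N → φ ((a + 1) * N) ≡ a * φ N
φ-prime-factor a N pr nd = +-cancelʳ-≡ (φ N) _ _ (begin
    φ ((a + 1) * N) + φ N
  ≡⟨ φ-prime-mul pr nd ⟩
    (a + 1) * φ N
  ≡⟨ ring a (φ N) ⟩
    a * φ N + φ N
  ∎)
  where
  ring : ∀ a f → (a + 1) * f ≡ a * f + f
  ring = solve-∀

prime-∣-prime : ∀ {q x} → Prime q → Prime x → q ∣ x → q ≡ x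
prime-∣-prime pq px q∣x with prime⇒irreducible px q∣x
... | inj₁ refl = ⊥-elim (¬prime[1] pq)
... | inj₂ q≡x  = q≡x

prime-∣-pow : ∀ {r} a n → Prime r → r ∣ a ^ n → r ∣ a
prime-∣-pow a zero    pr r∣1 = ⊥-elim (¬prime[1] (subst Prime (∣1⇒≡1 r∣1) pr))
prime-∣-pow a (suc n) pr r∣aⁿ⁺¹ with euclidsLemma a (a ^ n) pr r∣aⁿ⁺¹
... | inj₁ r∣a  = r∣a
... | inj₂ r∣aⁿ = prime-∣-pow a n pr r∣aⁿ

^-monoʳ-∣ : ∀ b {i j} → i ≤ j → b ^ i ∣ b ^ j
^-monoʳ-∣ b z≤n       = 1∣ _
^-monoʳ-∣ b (s≤s i≤j) = *-monoʳ-∣ b (^-monoʳ-∣ b i≤j)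

^-distribʳ-* : ∀ a b n → (a * b) ^ n ≡ a ^ n * b ^ n
^-distribʳ-* a b zero    = refl
^-distribʳ-* a b (suc n) = trans (cong (a * b *_) (^-distribʳ-* a b n)) (ring a b (a ^ n) (b ^ n))
  where
  ring : ∀ a b x y → a * b * (x * y) ≡ a * x * (b * y)
  ring = solve-∀

power-of-2-or-odd : ∀ fs → All Prime fs →
                    (∃[ e ] product fs ≡ 2 ^ e) ⊎ (∃[ ρ ] Prime ρ × ρ ∣ product fs × ¬ ρ ≡ 2)
power-of-2-or-odd []       []         = inj₁ (0 , refl)
power-of-2-or-odd (q ∷ qs) (pq ∷ pqs) with q ≟ 2
... | no  q≢2 = inj₂ (q , pq , m∣m*n (product qs) , q≢2)
... | yes refl with power-of-2-or-odd qs pqs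
...   | inj₁ (e , ∏≡2ᵉ)          = inj₁ (suc e , cong (2 *_) ∏≡2ᵉ)
...   | inj₂ (ρ , pρ , ρ∣∏ , ρ≢2) = inj₂ (ρ , pρ , ∣n⇒∣m*n 2 ρ∣∏ , ρ≢2)

odd-prime-divisor : ∀ m → 1 ≤ m → ¬ (∃[ e ] m ≡ 2 ^ e) → ∃[ ρ ] Prime ρ × ρ ∣ m × ¬ ρ ≡ 2
odd-prime-divisor (suc m') _ not-pow with factorise (suc m')
... | record { factors = fs ; isFactorisation = m≡∏fs ; factorsPrime = primes }
  with power-of-2-or-odd fs primes
...   | inj₁ (e , ∏≡2ᵉ)          = ⊥-elim (not-pow (e , trans m≡∏fs ∏≡2ᵉ))
...   | inj₂ (ρ , pρ , ρ∣∏ , ρ≢2) = ρ , pρ , subst (ρ ∣_) (sym m≡∏fs) ρ∣∏ , ρ≢2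

pow2-∣-4* : ∀ n {m} → 2 ^ (n ∸ 2) ∣ m → 2 ^ n ∣ 4 * m
pow2-∣-4* zero          {m} _ = 1∣ (4 * m)
pow2-∣-4* (suc zero)    {m} _ = ∣m⇒∣m*n m (divides 2 refl)
pow2-∣-4* (suc (suc n)) {m} d = subst (_∣ 4 * m) (ring (2 ^ n)) (*-monoʳ-∣ 4 d)
  where
  ring : ∀ w → 4 * w ≡ 2 * (2 * w)
  ring = solve-∀

product-applyUpTo-suc : ∀ (f : ℕ → ℕ) n →
                        product (applyUpTo f (suc n)) ≡ product (applyUpTo f n) * f n
product-applyUpTo-suc f n = begin
    product (applyUpTo f (suc n))
  ≡⟨ cong product (sym (applyUpTo-∷ʳ f n)) ⟩
    product (applyUpTo f n ∷ʳ f n)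
  ≡⟨ product-++ (applyUpTo f n) (f n ∷ []) ⟩
    product (applyUpTo f n) * (f n * 1)
  ≡⟨ cong (product (applyUpTo f n) *_) (*-identityʳ (f n)) ⟩
    product (applyUpTo f n) * f n
  ∎

prime-∣-product : ∀ {q} (f : ℕ → ℕ) n → Prime q → (∀ j → j < n → Prime (f j)) →
                  q ∣ product (applyUpTo f n) → ∃[ j ] j < n × q ≡ f j
prime-∣-product f n pq pf q∣∏ =
  ∈-applyUpTo⁻ f (factorisationHasAllPrimeFactors pq q∣∏ (applyUpTo⁺₁ f n (λ {i} → pf i)))

product-∣-pow : ∀ {c} (f : ℕ → ℕ) n → (∀ j → j < n → f j ∣ c) → product (applyUpTo f n) ∣ c ^ n
product-∣-pow f zero    _   = ∣-refl
product-∣-pow f (suc n) f∣c =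
  *-pres-∣ (f∣c 0 z<s) (product-∣-pow (f ∘ suc) n (λ j j<n → f∣c (suc j) (s<s j<n)))

pow-∣-product : ∀ {c} (f : ℕ → ℕ) n → (∀ j → j < n → c ∣ f j) → c ^ n ∣ product (applyUpTo f n)
pow-∣-product f zero    _   = ∣-refl
pow-∣-product f (suc n) c∣f =
  *-pres-∣ (c∣f 0 z<s) (pow-∣-product (f ∘ suc) n (λ j j<n → c∣f (suc j) (s<s j<n)))

-- For a strictly increasing a with all a j + 1 prime (hence distinct),
-- φ(∏_{j<n} (a j + 1)) = ∏_{j<n} a j.
φ-product-primes : (a : ℕ → ℕ) → (∀ {i j} → i < j → a i < a j) → ∀ n →
                   (∀ j → j < n → Prime (a j + 1)) →
                   φ (product (applyUpTo (λ j → a j + 1) n)) ≡ product (applyUpTo a n)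
φ-product-primes a a-mono zero    _      = refl
φ-product-primes a a-mono (suc n) primes = begin
    φ (product (applyUpTo g (suc n)))
  ≡⟨ cong φ (trans (product-applyUpTo-suc g n) (*-comm (product (applyUpTo g n)) (g n))) ⟩
    φ ((a n + 1) * product (applyUpTo g n))
  ≡⟨ φ-prime-factor (a n) _ (primes n ≤-refl) fresh ⟩
    a n * φ (product (applyUpTo g n))
  ≡⟨ cong (a n *_) (φ-product-primes a a-mono n earlier-primes) ⟩
    a n * product (applyUpTo a n)
  ≡⟨ *-comm (a n) _ ⟩
    product (applyUpTo a n) * a n
  ≡⟨ sym (product-applyUpTo-suc a n) ⟩
    product (applyUpTo a (suc n))
  ∎
  where
  g : ℕ → ℕ
  g j = a j + 1
  earlier-primes : ∀ j → j < n → Prime (g j)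
  earlier-primes j j<n = primes j (m<n⇒m<1+n j<n)
  fresh : ¬ g n ∣ product (applyUpTo g n)
  fresh gₙ∣∏ with prime-∣-product g n (primes n ≤-refl) earlier-primes gₙ∣∏
  ... | j , j<n , gₙ≡gⱼ = <-irrefl (sym (+-cancelʳ-≡ 1 (a n) (a j) gₙ≡gⱼ)) (a-mono j<n)

module Construction (m : ℕ) .{{_ : NonZero m}} where

  a : ℕ → ℕ
  a j = 9 * 2 ^ suc j * m

  Q : ℕ → ℕ
  Q n = product (applyUpTo (λ j → a j + 1) n)

  -- U k m = Uₙ (k - 2)
  Uₙ : ℕ → ℕ
  Uₙ n = (6 * m + 1) * (12 * m + 1) * Q n

  -- the value of φ(Uₙ n) when all its factors are prime
  Φ : ℕ → ℕ
  Φ n = 6 * m * (12 * m * product (applyUpTo a n))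

  -- Comparisons showing that 6m+1, 12m+1 and the a j + 1 are pairwise distinct.
  a-mono : ∀ {i j} → i < j → a i < a j
  a-mono i<j = *-monoˡ-< m (*-monoʳ-< 9 (^-monoʳ-< 2 (s≤s (s≤s z≤n)) (s<s i<j)))

  6m<12m : 6 * m < 12 * m
  6m<12m = *-monoˡ-< m (m<m+n 6 {6} z<s)

  12m<a : ∀ j → 12 * m < a j
  12m<a j = *-monoˡ-< m (<-≤-trans (m<m+n 12 {6} z<s) (*-monoʳ-≤ 9 (^-monoʳ-≤ 2 {1} {suc j} (s≤s z≤n))))

  φ-U : ∀ n → Prime (6 * m + 1) → Prime (12 * m + 1) → (∀ j → j < n → Prime (a j + 1)) →
        φ (Uₙ n) ≡ Φ n
  φ-U n p6 p12 pa = begin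
      φ ((6 * m + 1) * (12 * m + 1) * Q n)
    ≡⟨ cong φ (*-assoc (6 * m + 1) (12 * m + 1) (Q n)) ⟩
      φ ((6 * m + 1) * ((12 * m + 1) * Q n))
    ≡⟨ φ-prime-factor (6 * m) _ p6 6m+1∤ ⟩
      6 * m * φ ((12 * m + 1) * Q n)
    ≡⟨ cong (6 * m *_) (φ-prime-factor (12 * m) (Q n) p12 (∤Q (12 * m) p12 12m<a)) ⟩
      6 * m * (12 * m * φ (Q n))
    ≡⟨ cong (λ x → 6 * m * (12 * m * x)) (φ-product-primes a a-mono n pa) ⟩
      Φ n
    ∎
    where
    ∤Q : ∀ b → Prime (b + 1) → (∀ j → b < a j) → ¬ (b + 1) ∣ Q n
    ∤Q b pb below b+1∣Q with prime-∣-product (λ j → a j + 1) n pb pa b+1∣Q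
    ... | j , _ , b+1≡ = <-irrefl (+-cancelʳ-≡ 1 b (a j) b+1≡) (below j)
    6m+1∤ : ¬ (6 * m + 1) ∣ (12 * m + 1) * Q n
    6m+1∤ d with euclidsLemma (12 * m + 1) (Q n) p6 d
    ... | inj₁ d₁₂ = <-irrefl (+-cancelʳ-≡ 1 _ _ (prime-∣-prime p6 p12 d₁₂)) 6m<12m
    ... | inj₂ d_Q = ∤Q (6 * m) p6 (λ j → <-trans 6m<12m (12m<a j)) d_Q

  Q-expansion : ∀ n → ∃[ H ] ∃[ Z ] Q n ≡ 1 + 18 * m * H × H + 1 ≡ 2 ^ n + 2 * m * Z
  Q-expansion zero = 0 , 0 , ring₀ m , ring₁ m
    where
    ring₀ : ∀ m → 1 ≡ 1 + 18 * m * 0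
    ring₀ = solve-∀
    ring₁ : ∀ m → 0 + 1 ≡ 1 + 2 * m * 0
    ring₁ = solve-∀
  Q-expansion (suc n) with Q-expansion n
  ... | H , Z , Q≡ , H≡ = H + w + 2 * m * (9 * w * H) , Z + 9 * w * H , Q′≡ , H′≡
    where
    w : ℕ
    w = 2 ^ n
    Q′≡ : Q (suc n) ≡ 1 + 18 * m * (H + w + 2 * m * (9 * w * H))
    Q′≡ = begin
        Q (suc n)
      ≡⟨ product-applyUpTo-suc (λ j → a j + 1) n ⟩
        Q n * (a n + 1)
      ≡⟨ cong (_* (a n + 1)) Q≡ ⟩
        (1 + 18 * m * H) * (9 * (2 * w) * m + 1)
      ≡⟨ ring m H w ⟩
        1 + 18 * m * (H + w + 2 * m * (9 * w * H))
      ∎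
      where
      ring : ∀ m H w → (1 + 18 * m * H) * (9 * (2 * w) * m + 1)
                       ≡ 1 + 18 * m * (H + w + 2 * m * (9 * w * H))
      ring = solve-∀
    H′≡ : H + w + 2 * m * (9 * w * H) + 1 ≡ 2 * w + 2 * m * (Z + 9 * w * H)
    H′≡ = begin
        H + w + 2 * m * (9 * w * H) + 1
      ≡⟨ ring₁ H w (2 * m * (9 * w * H)) ⟩
        (H + 1) + w + 2 * m * (9 * w * H)
      ≡⟨ cong (λ x → x + w + 2 * m * (9 * w * H)) H≡ ⟩
        w + 2 * m * Z + w + 2 * m * (9 * w * H)
      ≡⟨ ring₂ m w Z H ⟩
        2 * w + 2 * m * (Z + 9 * w * H)
      ∎
      where
      ring₁ : ∀ H w x → H + w + x + 1 ≡ (H + 1) + w + x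
      ring₁ = solve-∀
      ring₂ : ∀ m w Z H → w + 2 * m * Z + w + 2 * m * (9 * w * H) ≡ 2 * w + 2 * m * (Z + 9 * w * H)
      ring₂ = solve-∀

  record Expansion (n : ℕ) : Set where
    field
      S W : ℕ
      U≡ : Uₙ n ≡ 1 + 9 * m * S
      S≡ : S ≡ 2 ^ suc n + 4 * m * W

  expansion : ∀ n → Expansion n
  expansion n with Q-expansion n
  ... | H , Z , Q≡ , H≡ = record
    { S  = 2 * (H + 1) + 8 * m + 36 * m * H * (1 + 4 * m)
    ; W  = Z + 2 + 9 * H * (1 + 4 * m)
    ; U≡ = trans (cong ((6 * m + 1) * (12 * m + 1) *_) Q≡) (ring₁ m H)
    ; S≡ = trans (cong (λ x → 2 * x + 8 * m + 36 * m * H * (1 + 4 * m)) H≡) (ring₂ m H Z (2 ^ n))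
    }
    where
    ring₁ : ∀ m H → (6 * m + 1) * (12 * m + 1) * (1 + 18 * m * H)
                    ≡ 1 + 9 * m * (2 * (H + 1) + 8 * m + 36 * m * H * (1 + 4 * m))
    ring₁ = solve-∀
    ring₂ : ∀ m H Z w → 2 * (w + 2 * m * Z) + 8 * m + 36 * m * H * (1 + 4 * m)
                        ≡ 2 * w + 4 * m * (Z + 2 + 9 * H * (1 + 4 * m))
    ring₂ = solve-∀

  module _ {n : ℕ} (E : Expansion n) where
    open Expansion E

    4∣S : 1 ≤ n → 4 ∣ S
    4∣S 1≤n = subst (4 ∣_) (sym S≡) (∣m∣n⇒∣m+n (^-monoʳ-∣ 2 (s≤s 1≤n)) (∣m⇒∣m*n W (m∣m*n m)))

    2ⁿ∣S : 2 ^ (n ∸ 2) ∣ m → 2 ^ n ∣ S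
    2ⁿ∣S 2^∣m = subst (2 ^ n ∣_) (sym S≡) (∣m∣n⇒∣m+n (n∣m*n 2) (∣m⇒∣m*n W (pow2-∣-4* n 2^∣m)))

    -- An odd prime factor ρ of m does not divide S ≡ 2^(n+1) (mod m), so m
    -- divides no power of S.
    m∤Sᵉ : ∀ {ρ} e → Prime ρ → ρ ∣ m → ¬ ρ ≡ 2 → ¬ m ∣ S ^ e
    m∤Sᵉ e pρ ρ∣m ρ≢2 m∣Sᵉ = ρ≢2 (prime-∣-prime pρ prime[2] (prime-∣-pow 2 (suc n) pρ ρ∣2ⁿ⁺¹))
      where
      ρ∣2ⁿ⁺¹ : _ ∣ 2 ^ suc n
      ρ∣2ⁿ⁺¹ = ∣m+n∣m⇒∣n (subst (_ ∣_) (trans S≡ (+-comm (2 ^ suc n) _))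
                                    (prime-∣-pow S e pρ (∣-trans ρ∣m m∣Sᵉ)))
                         (∣-trans ρ∣m (∣m⇒∣m*n W (n∣m*n 4)))

  Φ-∣ : ∀ n S → 4 ∣ S → 2 ^ n ∣ S → Φ n ∣ (9 * m * S) ^ suc (suc n)
  Φ-∣ n S (divides q S≡q*4) (divides r S≡r*2ⁿ) =
    *-pres-∣ 6m∣ (*-pres-∣ 12m∣ (product-∣-pow a n a∣))
    where
    9mS : ℕ
    9mS = 9 * m * S
    6m∣ : 6 * m ∣ 9mS
    6m∣ = divides (6 * q) (trans (cong (9 * m *_) S≡q*4) (ring m q))
      where
      ring : ∀ m q → 9 * m * (q * 4) ≡ 6 * q * (6 * m)
      ring = solve-∀
    12m∣ : 12 * m ∣ 9mS
    12m∣ = divides (3 * q) (trans (cong (9 * m *_) S≡q*4) (ring m q))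
      where
      ring : ∀ m q → 9 * m * (q * 4) ≡ 3 * q * (12 * m)
      ring = solve-∀
    a∣ : ∀ j → j < n → a j ∣ 9mS
    a∣ j j<n = ∣-trans (*-monoˡ-∣ m (*-monoʳ-∣ 9 (^-monoʳ-∣ 2 j<n)))
                       (divides r (trans (cong (9 * m *_) S≡r*2ⁿ) (ring m r (2 ^ n))))
      where
      ring : ∀ m r w → 9 * m * (r * w) ≡ r * (9 * w * m)
      ring = solve-∀

  -- m·(9m)^(n+1) ∣ Φ n, so Φ n ∣ (9mS)^(n+1) forces m ∣ S^(n+1).
  Φ-∣⇒m-∣ : ∀ n S → Φ n ∣ (9 * m * S) ^ suc n → m ∣ S ^ suc n
  Φ-∣⇒m-∣ n S Φ∣ = *-cancelˡ-∣ ((9 * m) ^ suc n) {{9mⁿ⁺¹≢0}}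
    (subst₂ _∣_ (*-comm m _) (^-distribʳ-* (9 * m) S (suc n)) (∣-trans m[9m]ⁿ⁺¹∣Φ Φ∣))
    where
    9mⁿ⁺¹≢0 : NonZero ((9 * m) ^ suc n)
    9mⁿ⁺¹≢0 = m^n≢0 (9 * m) (suc n) {{m*n≢0 9 m}}
    m[9m]ⁿ⁺¹∣Φ : m * (9 * m) ^ suc n ∣ Φ n
    m[9m]ⁿ⁺¹∣Φ = ∣-trans (divides 8 (ring m ((9 * m) ^ n)))
      (*-monoʳ-∣ (6 * m) (*-monoʳ-∣ (12 * m)
        (pow-∣-product a n (λ j _ → divides (2 ^ suc j) (ring′ m (2 ^ suc j))))))
      where
      ring : ∀ m x → 6 * m * (12 * m * x) ≡ 8 * (m * (9 * m * x))
      ring = solve-∀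
      ring′ : ∀ m w → 9 * w * m ≡ w * (9 * m)
      ring′ = solve-∀

mainTheorem8 : (k m : ℕ) → 2 < k → 1 ≤ m →
    Prime (6 * m + 1) → Prime (12 * m + 1) →
    ((i : ℕ) → 1 ≤ i → i ≤ k ∸ 2 → Prime (9 * 2 ^ i * m + 1)) →
    2 ^ (k ∸ 4) ∣ m →
    ¬ (∃[ e ] m ≡ 2 ^ e) →
    L k (U k m) × ¬ L (k ∸ 1) (U k m)
mainTheorem8 (suc (suc n)) m (s≤s (s≤s 1≤n)) 1≤m p6 p12 pg 2^∣m not-pow = U∈Lₖ , U∉Lₖ₋₁
  where
  open Construction m {{>-nonZero 1≤m}}
  open Expansion (expansion n)
  φU≡Φ : φ (Uₙ n) ≡ Φ n
  φU≡Φ = φ-U n p6 p12 (λ j j<n → pg (suc j) (s≤s z≤n) j<n)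
  U-1≡ : Uₙ n ∸ 1 ≡ 9 * m * S
  U-1≡ = cong (_∸ 1) U≡
  U∈Lₖ : L (suc (suc n)) (Uₙ n)
  U∈Lₖ = subst₂ _∣_ (sym φU≡Φ) (cong (_^ suc (suc n)) (sym U-1≡))
                (Φ-∣ n S (4∣S (expansion n) 1≤n) (2ⁿ∣S (expansion n) 2^∣m))
  U∉Lₖ₋₁ : ¬ L (suc n) (Uₙ n)
  U∉Lₖ₋₁ U∈L =
    let (ρ , pρ , ρ∣m , ρ≢2) = odd-prime-divisor m 1≤m not-pow
    in  m∤Sᵉ (expansion n) (suc n) pρ ρ∣m ρ≢2
          (Φ-∣⇒m-∣ n S (subst₂ _∣_ φU≡Φ (cong (_^ suc n) U-1≡) U∈L))
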